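{- Let $G$ be a graph on vertex set $\{v_1,\dots,v_n\}$ whose adjacency matrix $A_G$ has rank $2k$ over $\mathbb{F}_2$, and let $M \in \mathbb{F}_2^{n \times 2k}$ satisfy $M A_k M^\mathsf{T} = A_G$ over $\mathbb{F}_2$, where $A_k$ is the block-diagonal direct sum of $k$ copies of $\left( \begin{smallmatrix} 0 & 1 \\ 1 & 0 \end{smallmatrix} \right)$. Then for any subset $S \subseteq \{1,\ldots,n\}$, the set of rows of $M$ indexed by $S$ is linearly independent over $\mathbb{F}_2$ if and only if the set of rows of $A_G$ indexed by $S$ is linearly independent over $\mathbb{F}_2$.
   Context: All graphs are finite and simple. $A_G$ denotes the adjacency matrix of $G$; all ranks are over $\mathbb{F}_2$. -}

module Defs where

open import Data.Bool using (Bool; true; false; _xor_; _∧_)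
open import Data.Nat using (ℕ; zero; suc; _≡ᵇ_; _≤_; _*_)
open import Data.Fin using (Fin; toℕ) renaming (zero to fzero; suc to fsuc)
open import Data.Fin.Subset using (Subset; _∈_; ∣_∣)
open import Data.Product using (Σ; _×_)
open import Relation.Binary.PropositionalEquality using (_≡_)

-- The field F₂ is modelled by Bool: addition is xor, multiplication is ∧.

Matrix : ℕ → ℕ → Set
Matrix m n = Fin m → Fin n → Bool

sumF₂ : ∀ {n} → (Fin n → Bool) → Bool
sumF₂ {zero}  f = false
sumF₂ {suc n} f = f fzero xor sumF₂ (λ i → f (fsuc i))

_⊗_ : ∀ {m n p} → Matrix m n → Matrix n p → Matrix m p
(A ⊗ B) i j = sumF₂ (λ l → A i l ∧ B l j)

transpose : ∀ {m n} → Matrix m n → Matrix n m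
transpose A i j = A j i

record Graph (n : ℕ) : Set where
  field
    adj   : Matrix n n
    sym   : ∀ i j → adj i j ≡ adj j i
    irrefl : ∀ i → adj i i ≡ false

open Graph public

partner : ℕ → ℕ
partner zero = suc zero
partner (suc zero) = zero
partner (suc (suc m)) = suc (suc (partner m))

-- A_k : the direct sum of k copies of [[0,1],[1,0]], a 2k × 2k matrix.
Ak : (k : ℕ) → Matrix (2 * k) (2 * k)
Ak k i j = toℕ j ≡ᵇ partner (toℕ i)

RowsIndependent : ∀ {m n} → Matrix m n → Subset m → Set
RowsIndependent {m} {n} A S =
  (c : Fin m → Bool) →
  (∀ i → c i ≡ true → i ∈ S) →
  (∀ j → sumF₂ (λ i → c i ∧ A i j) ≡ false) →
  ∀ i → c i ≡ false

HasRank : ∀ {m n} → Matrix m n → ℕ → Set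
HasRank {m} A r =
  Σ (Subset m) (λ S → ∣ S ∣ ≡ r × RowsIndependent A S)
  × (∀ S → RowsIndependent A S → ∣ S ∣ ≤ r)

{-# OPTIONS --safe #-}

-- Everything rests on  c ⊙ A_G = ((c ⊙ M) ⊙ A_k) ⊙ Mᵀ  for row vectors c.  Hence a vanishing
-- combination of the rows of M gives one of the rows of A_G with the same coefficients.
-- Conversely, A_G has 2k independent rows, hence so does M, which has only 2k columns; since
-- independent rows never outnumber columns (Gaussian elimination), the columns of M are
-- independent, i.e. x ↦ x ⊙ Mᵀ is injective.  So is x ↦ x ⊙ A_k, as A_k permutes coordinates,
-- and therefore c ⊙ A_G = 0 forces c ⊙ M = 0.

module Submission where

open import Defs hiding (sym)

open import Algebra.Bundles using (CommutativeRing)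
open import Data.Bool using (Bool; true; false; _xor_; _∧_)
open import Data.Bool.Properties
  using (xor-∧-commutativeRing; xor-identityʳ; xor-same; ∧-assoc; ∧-comm; ∧-identityʳ; ∧-zeroʳ;
         ∧-distribˡ-xor; ∧-distribʳ-xor; ¬-not; not-¬)
  renaming (_≟_ to _≟ᵇ_)
open import Data.Fin using (Fin; zero; suc; toℕ; fromℕ<; punchOut)
open import Data.Fin.Properties using (_≟_; any?; punchInᵢ≢i; punchIn-punchOut; toℕ<n; toℕ-fromℕ<)
open import Data.Fin.Subset using (Subset; _∈_; _∉_; ∣_∣; ⊤; _-_; Empty; inside; outside)
open import Data.Fin.Subset.Properties using (_∈?_; ∈⊤; Empty-unique; ∣⊥∣≡0; p─⊥≡p; p─q⊆p)
open import Data.Nat using (ℕ; zero; suc; _*_; _≤_; _<_; z≤n; s≤s; _≡ᵇ_)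
open import Data.Nat.Properties using (≤-reflexive; ≤-trans; m≤n⇒m≤1+n; 1+n≰n; *-comm)
open import Data.Product using (_,_)
open import Data.Vec.Base using (_∷_; here; there)
open import Data.Vec.Functional using (removeAt; tail)
open import Function.Base using (_∘_; flip; case_of_)
open import Function.Bundles using (_⇔_; mk⇔)
open import Relation.Nullary using (yes; no; does; contradiction)
open import Relation.Nullary.Decidable using (dec-true; dec-false; _×-dec_)
open import Relation.Binary.PropositionalEquality
  using (_≡_; _≢_; _≗_; refl; sym; trans; cong; cong₂; subst; module ≡-Reasoning)

open import Algebra.Properties.Semiring.Sum (CommutativeRing.semiring xor-∧-commutativeRing)
  using (sum; sum-cong-≗; sum-replicate-zero; ∑-distrib-+; ∑-comm; sum-remove;
         *-distribˡ-sum; *-distribʳ-sum)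

open ≡-Reasoning

private
  variable
    m n : ℕ

xor≡false⇒≡ : ∀ {x y} → x xor y ≡ false → x ≡ y
xor≡false⇒≡ {false} {false} _  = refl
xor≡false⇒≡ {false} {true}  ()
xor≡false⇒≡ {true}  {false} ()
xor≡false⇒≡ {true}  {true}  _  = refl

sumF₂≗sum : sumF₂ {n} ≗ sum
sumF₂≗sum {zero}  f = refl
sumF₂≗sum {suc n} f = cong (f zero xor_) (sumF₂≗sum (f ∘ suc))

sumF₂-cong : {f g : Fin n → Bool} → f ≗ g → sumF₂ f ≡ sumF₂ g
sumF₂-cong {f = f} {g} f≗g =
  trans (sumF₂≗sum f) (trans (sum-cong-≗ f≗g) (sym (sumF₂≗sum g)))

sumF₂-false : {f : Fin n → Bool} → (∀ i → f i ≡ false) → sumF₂ f ≡ false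
sumF₂-false {n} f≡false =
  trans (sumF₂-cong f≡false) (trans (sumF₂≗sum {n} (λ _ → false)) (sum-replicate-zero n))

sumF₂-xor : (f g : Fin n → Bool) → sumF₂ (λ i → f i xor g i) ≡ sumF₂ f xor sumF₂ g
sumF₂-xor f g = begin
  sumF₂ (λ i → f i xor g i) ≡⟨ sumF₂≗sum (λ i → f i xor g i) ⟩
  sum (λ i → f i xor g i)   ≡⟨ ∑-distrib-+ f g ⟩
  sum f xor sum g           ≡⟨ cong₂ _xor_ (sumF₂≗sum f) (sumF₂≗sum g) ⟨
  sumF₂ f xor sumF₂ g       ∎

∧-distribˡ-sumF₂ : ∀ a (f : Fin n → Bool) → a ∧ sumF₂ f ≡ sumF₂ (λ i → a ∧ f i)
∧-distribˡ-sumF₂ a f =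
  trans (cong (a ∧_) (sumF₂≗sum f))
        (trans (*-distribˡ-sum a f) (sym (sumF₂≗sum (λ i → a ∧ f i))))

∧-distribʳ-sumF₂ : ∀ a (f : Fin n → Bool) → sumF₂ f ∧ a ≡ sumF₂ (λ i → f i ∧ a)
∧-distribʳ-sumF₂ a f =
  trans (cong (_∧ a) (sumF₂≗sum f))
        (trans (*-distribʳ-sum a f) (sym (sumF₂≗sum (λ i → f i ∧ a))))

sumF₂-comm : (f : Fin m → Fin n → Bool) →
  sumF₂ (λ i → sumF₂ (f i)) ≡ sumF₂ (λ j → sumF₂ (λ i → f i j))
sumF₂-comm f = trans (sumF₂²≡sum² f) (trans (∑-comm f) (sym (sumF₂²≡sum² (flip f))))
  where
  sumF₂²≡sum² : (g : Fin m → Fin n → Bool) → sumF₂ (λ i → sumF₂ (g i)) ≡ sum (λ i → sum (g i))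
  sumF₂²≡sum² g = trans (sumF₂≗sum (λ i → sumF₂ (g i))) (sum-cong-≗ (sumF₂≗sum ∘ g))

sumF₂-remove : ∀ (p : Fin (suc n)) f → sumF₂ f ≡ f p xor sumF₂ (removeAt f p)
sumF₂-remove p f =
  trans (sumF₂≗sum f) (trans (sum-remove f) (cong (f p xor_) (sym (sumF₂≗sum (removeAt f p)))))

sumF₂-single : ∀ (p : Fin n) f → (∀ i → i ≢ p → f i ≡ false) → sumF₂ f ≡ f p
sumF₂-single {suc n} p f f≡false = begin
  sumF₂ f                      ≡⟨ sumF₂-remove p f ⟩
  f p xor sumF₂ (removeAt f p) ≡⟨ cong (f p xor_) (sumF₂-false (f≡false _ ∘ punchInᵢ≢i p)) ⟩
  f p xor false                ≡⟨ xor-identityʳ (f p) ⟩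
  f p                          ∎

infix 7 _·_
infixl 6 _⊙_

_·_ : (Fin n → Bool) → (Fin n → Bool) → Bool
x · y = sumF₂ (λ i → x i ∧ y i)

_⊙_ : (Fin m → Bool) → Matrix m n → Fin n → Bool
(c ⊙ A) j = c · (λ i → A i j)

·-comm : (x y : Fin n → Bool) → x · y ≡ y · x
·-comm x y = sumF₂-cong (λ i → ∧-comm (x i) (y i))

⊙-· : ∀ (c : Fin m → Bool) (A : Matrix m n) b → (c ⊙ A) · b ≡ c · (λ i → A i · b)
⊙-· c A b = begin
  sumF₂ (λ l → sumF₂ (λ i → c i ∧ A i l) ∧ b l)
    ≡⟨ sumF₂-cong (λ l → ∧-distribʳ-sumF₂ (b l) (λ i → c i ∧ A i l)) ⟩
  sumF₂ (λ l → sumF₂ (λ i → (c i ∧ A i l) ∧ b l))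
    ≡⟨ sumF₂-comm (λ i l → (c i ∧ A i l) ∧ b l) ⟨
  sumF₂ (λ i → sumF₂ (λ l → (c i ∧ A i l) ∧ b l))
    ≡⟨ sumF₂-cong (λ i → sumF₂-cong (λ l → ∧-assoc (c i) (A i l) (b l))) ⟩
  sumF₂ (λ i → sumF₂ (λ l → c i ∧ (A i l ∧ b l)))
    ≡⟨ sumF₂-cong (λ i → ∧-distribˡ-sumF₂ (c i) (λ l → A i l ∧ b l)) ⟨
  sumF₂ (λ i → c i ∧ sumF₂ (λ l → A i l ∧ b l))
    ∎

⊙-⊗ : ∀ (c : Fin m → Bool) (A : Matrix m n) {p} (B : Matrix n p) j →
  (c ⊙ (A ⊗ B)) j ≡ (c ⊙ A ⊙ B) j
⊙-⊗ c A B j = sym (⊙-· c A (λ l → B l j))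

δ : Fin n → Fin n → Bool
δ p i = does (p ≟ i)

δ-diag : ∀ (p : Fin n) → δ p p ≡ true
δ-diag p = dec-true (p ≟ p) refl

δ-· : ∀ (p : Fin n) y → δ p · y ≡ y p
δ-· p y = trans (sumF₂-single p (λ i → δ p i ∧ y i) off-p) (cong (_∧ y p) (δ-diag p))
  where
  off-p : ∀ i → i ≢ p → δ p i ∧ y i ≡ false
  off-p i i≢p = cong (_∧ y i) (dec-false (p ≟ i) (i≢p ∘ sym))

δ≡true⇒≡ : ∀ {p i : Fin n} → δ p i ≡ true → p ≡ i
δ≡true⇒≡ {p = p} {i} δₚᵢ≡true with p ≟ i
... | yes p≡i = p≡i
... | no  _   = case δₚᵢ≡true of λ ()

RowsIndependent-cong : ∀ {A B : Matrix m n} {S} → (∀ i j → A i j ≡ B i j) →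
  RowsIndependent A S → RowsIndependent B S
RowsIndependent-cong A≡B A-indep c c⊆S c⊙B≡0 =
  A-indep c c⊆S (λ j → trans (sumF₂-cong (λ i → cong (c i ∧_) (A≡B i j))) (c⊙B≡0 j))

RowsIndependent-⊗⁻ : ∀ {p} {A : Matrix m n} {B : Matrix n p} {S} →
  RowsIndependent (A ⊗ B) S → RowsIndependent A S
RowsIndependent-⊗⁻ {A = A} {B} AB-indep c c⊆S c⊙A≡0 = AB-indep c c⊆S λ j → begin
  (c ⊙ (A ⊗ B)) j ≡⟨ ⊙-⊗ c A B j ⟩
  (c ⊙ A ⊙ B) j   ≡⟨ sumF₂-false (λ l → cong (_∧ B l j) (c⊙A≡0 l)) ⟩
  false           ∎

RowsIndependent-⊗ : ∀ {p} {A : Matrix m n} {B : Matrix n p} {S} →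
  RowsIndependent A S → RowsIndependent B ⊤ → RowsIndependent (A ⊗ B) S
RowsIndependent-⊗ {A = A} {B} A-indep B-indep c c⊆S c⊙AB≡0 =
  A-indep c c⊆S (B-indep (c ⊙ A) (λ _ _ → ∈⊤) (λ j → trans (sym (⊙-⊗ c A B j)) (c⊙AB≡0 j)))

x∉p-x : ∀ {x : Fin n} {p} → x ∉ p - x
x∉p-x {x = zero}  {_ ∷ _} ()
x∉p-x {x = suc x} {_ ∷ _} (there x∈p-x) = x∉p-x x∈p-x

x∈p⇒∣p∣≡1+∣p-x∣ : ∀ {x : Fin n} {p} → x ∈ p → ∣ p ∣ ≡ suc ∣ p - x ∣
x∈p⇒∣p∣≡1+∣p-x∣ {p = inside ∷ p}  here        = cong (suc ∘ ∣_∣) (sym (p─⊥≡p p))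
x∈p⇒∣p∣≡1+∣p-x∣ {p = inside ∷ p}  (there x∈p) = cong suc (x∈p⇒∣p∣≡1+∣p-x∣ x∈p)
x∈p⇒∣p∣≡1+∣p-x∣ {p = outside ∷ p} (there x∈p) = x∈p⇒∣p∣≡1+∣p-x∣ x∈p

RowsIndependent-tail : ∀ {V : Matrix m (suc n)} {S} → (∀ i → i ∈ S → V i zero ≡ false) →
  RowsIndependent V S → RowsIndependent (tail ∘ V) S
RowsIndependent-tail {V = V} V₀≡0 V-indep c c⊆S c⊙tailV≡0 = V-indep c c⊆S c⊙V≡0
  where
  cᵢVᵢ₀≡0 : ∀ i → c i ∧ V i zero ≡ false
  cᵢVᵢ₀≡0 i with c i in cᵢ≡true
  ... | false = refl
  ... | true  = V₀≡0 i (c⊆S i cᵢ≡true)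
  c⊙V≡0 : ∀ j → (c ⊙ V) j ≡ false
  c⊙V≡0 zero    = sumF₂-false cᵢVᵢ₀≡0
  c⊙V≡0 (suc j) = c⊙tailV≡0 j

⊙-add-row : ∀ (c : Fin m → Bool) a p (V : Matrix m n) l →
  ((λ i → c i xor (a ∧ δ p i)) ⊙ V) l ≡ (c ⊙ V) l xor (a ∧ V p l)
⊙-add-row c a p V l = begin
  sumF₂ (λ i → (c i xor (a ∧ δ p i)) ∧ V i l)
    ≡⟨ sumF₂-cong (λ i → ∧-distribʳ-xor (V i l) (c i) (a ∧ δ p i)) ⟩
  sumF₂ (λ i → (c i ∧ V i l) xor ((a ∧ δ p i) ∧ V i l))
    ≡⟨ sumF₂-cong (λ i → cong ((c i ∧ V i l) xor_) (∧-assoc a (δ p i) (V i l))) ⟩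
  sumF₂ (λ i → (c i ∧ V i l) xor (a ∧ (δ p i ∧ V i l)))
    ≡⟨ sumF₂-xor (λ i → c i ∧ V i l) (λ i → a ∧ (δ p i ∧ V i l)) ⟩
  (c ⊙ V) l xor sumF₂ (λ i → a ∧ (δ p i ∧ V i l))
    ≡⟨ cong ((c ⊙ V) l xor_) (∧-distribˡ-sumF₂ a (λ i → δ p i ∧ V i l)) ⟨
  (c ⊙ V) l xor (a ∧ (δ p · (λ i → V i l)))
    ≡⟨ cong (λ v → (c ⊙ V) l xor (a ∧ v)) (δ-· p (λ i → V i l)) ⟩
  (c ⊙ V) l xor (a ∧ V p l)
    ∎

eliminate : Matrix m (suc n) → Fin m → Matrix m n
eliminate V p i j = V i (suc j) xor (V i zero ∧ V p (suc j))

⊙-eliminate : ∀ (c : Fin m → Bool) (V : Matrix m (suc n)) p j →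
  (c ⊙ eliminate V p) j ≡ (c ⊙ V) (suc j) xor ((c ⊙ V) zero ∧ V p (suc j))
⊙-eliminate c V p j = begin
  sumF₂ (λ i → c i ∧ (V i (suc j) xor (V i zero ∧ V p (suc j))))
    ≡⟨ sumF₂-cong (λ i → ∧-distribˡ-xor (c i) (V i (suc j)) (V i zero ∧ V p (suc j))) ⟩
  sumF₂ (λ i → (c i ∧ V i (suc j)) xor (c i ∧ (V i zero ∧ V p (suc j))))
    ≡⟨ sumF₂-cong (λ i → cong ((c i ∧ V i (suc j)) xor_) (∧-assoc (c i) (V i zero) (V p (suc j)))) ⟨
  sumF₂ (λ i → (c i ∧ V i (suc j)) xor ((c i ∧ V i zero) ∧ V p (suc j)))
    ≡⟨ sumF₂-xor (λ i → c i ∧ V i (suc j)) (λ i → (c i ∧ V i zero) ∧ V p (suc j)) ⟩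
  (c ⊙ V) (suc j) xor sumF₂ (λ i → (c i ∧ V i zero) ∧ V p (suc j))
    ≡⟨ cong ((c ⊙ V) (suc j) xor_) (∧-distribʳ-sumF₂ (V p (suc j)) (λ i → c i ∧ V i zero)) ⟨
  (c ⊙ V) (suc j) xor ((c ⊙ V) zero ∧ V p (suc j))
    ∎

RowsIndependent-eliminate : ∀ {V : Matrix m (suc n)} {S p} → p ∈ S → V p zero ≡ true →
  RowsIndependent V S → RowsIndependent (eliminate V p) (S - p)
RowsIndependent-eliminate {V = V} {S} {p} p∈S Vₚ₀≡true V-indep c c⊆S-p c⊙W≡0 = cᵢ≡0
  where
  a : Bool
  a = (c ⊙ V) zero
  c′ : Fin _ → Bool
  c′ i = c i xor (a ∧ δ p i)
  c′≡c : ∀ i → p ≢ i → c′ i ≡ c i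
  c′≡c i p≢i = begin
    c i xor (a ∧ δ p i) ≡⟨ cong (λ b → c i xor (a ∧ b)) (dec-false (p ≟ i) p≢i) ⟩
    c i xor (a ∧ false) ≡⟨ cong (c i xor_) (∧-zeroʳ a) ⟩
    c i xor false       ≡⟨ xor-identityʳ (c i) ⟩
    c i                 ∎
  c′⊆S : ∀ i → c′ i ≡ true → i ∈ S
  c′⊆S i c′ᵢ≡true = case p ≟ i of λ where
    (yes refl) → p∈S
    (no  p≢i)  → p─q⊆p S _ (c⊆S-p i (trans (sym (c′≡c i p≢i)) c′ᵢ≡true))
  c′⊙V≡0 : ∀ l → (c′ ⊙ V) l ≡ false
  c′⊙V≡0 zero = begin
    (c′ ⊙ V) zero             ≡⟨ ⊙-add-row c a p V zero ⟩
    a xor (a ∧ V p zero)      ≡⟨ cong (λ v → a xor (a ∧ v)) Vₚ₀≡true ⟩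
    a xor (a ∧ true)          ≡⟨ cong (a xor_) (∧-identityʳ a) ⟩
    a xor a                   ≡⟨ xor-same a ⟩
    false                     ∎
  c′⊙V≡0 (suc j) = begin
    (c′ ⊙ V) (suc j)                      ≡⟨ ⊙-add-row c a p V (suc j) ⟩
    (c ⊙ V) (suc j) xor (a ∧ V p (suc j)) ≡⟨ ⊙-eliminate c V p j ⟨
    (c ⊙ eliminate V p) j                 ≡⟨ c⊙W≡0 j ⟩
    false                                 ∎
  cᵢ≡0 : ∀ i → c i ≡ false
  cᵢ≡0 i with p ≟ i
  ... | yes refl = ¬-not (x∉p-x ∘ c⊆S-p p)
  ... | no  p≢i  = trans (sym (c′≡c i p≢i)) (V-indep c′ c′⊆S c′⊙V≡0 i)

RowsIndependent⇒∣S∣≤n : ∀ n (V : Matrix m n) S → RowsIndependent V S → ∣ S ∣ ≤ n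
RowsIndependent⇒∣S∣≤n {m} zero V S V-indep =
  ≤-reflexive (trans (cong ∣_∣ (Empty-unique S-empty)) (∣⊥∣≡0 m))
  where
  S-empty : Empty S
  S-empty (p , p∈S) = not-¬ (δ-diag p) (V-indep (δ p) δₚ⊆S (λ ()) p)
    where
    δₚ⊆S : ∀ i → δ p i ≡ true → i ∈ S
    δₚ⊆S i δₚᵢ≡true = subst (_∈ S) (δ≡true⇒≡ δₚᵢ≡true) p∈S
RowsIndependent⇒∣S∣≤n (suc n) V S V-indep with any? (λ i → i ∈? S ×-dec V i zero ≟ᵇ true)
... | yes (p , p∈S , Vₚ₀≡true) =
  ≤-trans (≤-reflexive (x∈p⇒∣p∣≡1+∣p-x∣ p∈S))
          (s≤s (RowsIndependent⇒∣S∣≤n n (eliminate V p) (S - p)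
                  (RowsIndependent-eliminate p∈S Vₚ₀≡true V-indep)))
... | no ∄pivot =
  m≤n⇒m≤1+n (RowsIndependent⇒∣S∣≤n n (tail ∘ V) S
    (RowsIndependent-tail (λ i i∈S → ¬-not (λ Vᵢ₀≡true → ∄pivot (i , i∈S , Vᵢ₀≡true))) V-indep))

RowsIndependent-removeColumn : ∀ {M : Matrix m (suc n)} {S} l z →
  (∀ i → M i l ≡ removeAt (M i) l · z) →
  RowsIndependent M S → RowsIndependent (λ i → removeAt (M i) l) S
RowsIndependent-removeColumn {M = M} l z Mₗ≡M′z M-indep c c⊆S c⊙M′≡0 = M-indep c c⊆S c⊙M≡0
  where
  M′ = λ i → removeAt (M i) l
  c⊙M≡0 : ∀ j → (c ⊙ M) j ≡ false
  c⊙M≡0 j = case l ≟ j of λ where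
    (yes refl) → begin
      (c ⊙ M) l            ≡⟨ sumF₂-cong (λ i → cong (c i ∧_) (Mₗ≡M′z i)) ⟩
      c · (λ i → M′ i · z) ≡⟨ ⊙-· c M′ z ⟨
      (c ⊙ M′) · z         ≡⟨ sumF₂-false (λ j → cong (_∧ z j) (c⊙M′≡0 j)) ⟩
      false                ∎
    (no l≢j) → subst (λ j → (c ⊙ M) j ≡ false) (punchIn-punchOut l≢j) (c⊙M′≡0 (punchOut l≢j))

RowsIndependent-transpose : ∀ (M : Matrix m n) S → RowsIndependent M S → ∣ S ∣ ≡ n →
  RowsIndependent (transpose M) ⊤
RowsIndependent-transpose {n = suc n} M S M-indep ∣S∣≡1+n z _ zMᵀ≡0 l with z l in zₗ≡true
... | false = refl
... | true  = contradiction (subst (_≤ n) ∣S∣≡1+n (RowsIndependent⇒∣S∣≤n n _ S M′-indep)) 1+n≰n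
  where
  column-dependent : ∀ i → M i l ≡ removeAt (M i) l · removeAt z l
  column-dependent i = xor≡false⇒≡ (begin
    M i l xor (removeAt (M i) l · removeAt z l)
      ≡⟨ cong₂ _xor_ (cong (_∧ M i l) zₗ≡true) (·-comm (removeAt z l) (removeAt (M i) l)) ⟨
    (z l ∧ M i l) xor (removeAt z l · removeAt (M i) l)
      ≡⟨ sumF₂-remove l (λ j → z j ∧ M i j) ⟨
    z · M i
      ≡⟨ zMᵀ≡0 i ⟩
    false
      ∎)
  M′-indep : RowsIndependent (λ i → removeAt (M i) l) S
  M′-indep = RowsIndependent-removeColumn l (removeAt z l) column-dependent M-indep

partner-< : ∀ k {m} → m < 2 * k → partner m < 2 * k
partner-< k {m} m<2k = subst (partner m <_) (*-comm k 2) (go m k (subst (m <_) (*-comm 2 k) m<2k))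
  where
  go : ∀ m k → m < k * 2 → partner m < k * 2
  go zero          (suc k) _                 = s≤s (s≤s z≤n)
  go (suc zero)    (suc k) _                 = s≤s z≤n
  go (suc (suc m)) (suc k) (s≤s (s≤s m<2k)) = s≤s (s≤s (go m k m<2k))

partner-≡ᵇ : ∀ a b → (partner a ≡ᵇ partner b) ≡ (a ≡ᵇ b)
partner-≡ᵇ zero          zero          = refl
partner-≡ᵇ zero          (suc zero)    = refl
partner-≡ᵇ zero          (suc (suc b)) = refl
partner-≡ᵇ (suc zero)    zero          = refl
partner-≡ᵇ (suc zero)    (suc zero)    = refl
partner-≡ᵇ (suc zero)    (suc (suc b)) = refl
partner-≡ᵇ (suc (suc a)) zero          = refl
partner-≡ᵇ (suc (suc a)) (suc zero)    = refl
partner-≡ᵇ (suc (suc a)) (suc (suc b)) = partner-≡ᵇ a b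

toℕ-≡ᵇ : ∀ (p q : Fin n) → (toℕ p ≡ᵇ toℕ q) ≡ δ p q
toℕ-≡ᵇ zero    zero    = refl
toℕ-≡ᵇ zero    (suc q) = refl
toℕ-≡ᵇ (suc p) zero    = refl
toℕ-≡ᵇ (suc p) (suc q) = toℕ-≡ᵇ p q

partnerᶠ : ∀ k → Fin (2 * k) → Fin (2 * k)
partnerᶠ k p = fromℕ< (partner-< k (toℕ<n p))

Ak-partnerᶠ : ∀ k (p q : Fin (2 * k)) → Ak k q (partnerᶠ k p) ≡ δ p q
Ak-partnerᶠ k p q = begin
  toℕ (partnerᶠ k p) ≡ᵇ partner (toℕ q)
    ≡⟨ cong (_≡ᵇ partner (toℕ q)) (toℕ-fromℕ< (partner-< k (toℕ<n p))) ⟩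
  partner (toℕ p) ≡ᵇ partner (toℕ q)
    ≡⟨ partner-≡ᵇ (toℕ p) (toℕ q) ⟩
  toℕ p ≡ᵇ toℕ q
    ≡⟨ toℕ-≡ᵇ p q ⟩
  δ p q
    ∎

Ak-independent : ∀ k → RowsIndependent (Ak k) ⊤
Ak-independent k x _ x⊙Ak≡0 p = begin
  x p                       ≡⟨ δ-· p x ⟨
  δ p · x                   ≡⟨ ·-comm (δ p) x ⟩
  x · δ p                   ≡⟨ sumF₂-cong (λ q → cong (x q ∧_) (Ak-partnerᶠ k p q)) ⟨
  (x ⊙ Ak k) (partnerᶠ k p) ≡⟨ x⊙Ak≡0 (partnerᶠ k p) ⟩
  false                     ∎

theorem3 : (n k : ℕ) (G : Graph n) (M : Matrix n (2 * k)) →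
    HasRank (adj G) (2 * k) →
    (∀ i j → ((M ⊗ Ak k) ⊗ transpose M) i j ≡ adj G i j) →
    (S : Subset n) → (RowsIndependent M S ⇔ RowsIndependent (adj G) S)
theorem3 n k G M ((S₀ , ∣S₀∣≡2k , A-indep-S₀) , _) MAkMᵀ≡A S =
  mk⇔ (λ M-indep → RowsIndependent-cong MAkMᵀ≡A
                     (RowsIndependent-⊗ (RowsIndependent-⊗ M-indep (Ak-independent k)) Mᵀ-indep))
      M-indep-of
  where
  M-indep-of : ∀ {T} → RowsIndependent (adj G) T → RowsIndependent M T
  M-indep-of = RowsIndependent-⊗⁻ {B = Ak k} ∘ RowsIndependent-⊗⁻ {B = transpose M}
             ∘ RowsIndependent-cong (λ i j → sym (MAkMᵀ≡A i j))
  Mᵀ-indep : RowsIndependent (transpose M) ⊤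
  Mᵀ-indep = RowsIndependent-transpose M S₀ (M-indep-of A-indep-S₀) ∣S₀∣≡2k
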